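{- Let $\mathcal{T}_S$ be any source theory, $\mathcal{T}_B$ a bridging theory, $\mathcal{V}_A$ any vocabulary, and let $\langle \mathcal{T}^l,\mathcal{T}^u\rangle$ be an $\alpha$-abstraction from $\mathcal{T}_S$ with respect to $\mathcal{T}_B$ over $\mathcal{V}_A$. Then $\langle \mathcal{T}^l,\mathcal{T}^u\rangle$ is an approximate theory under $\mathcal{T}_B$, i.e. $\mathcal{T}_B\models \mathcal{T}^l\rightarrow\mathcal{T}^u$.
   Context: Classical propositional logic. A theory is a finite set of formulas identified with the conjunction of its members; its vocabulary is the set of propositional variables occurring in it; "a formula over $\mathcal{V}$" means all its variables lie in $\mathcal{V}$. $\models$ is classical entailment. An approximate theory (approximation) under a theory $\mathcal{T}$ is a pair $\langle\mathcal{T}^l,\mathcal{T}^u\rangle$ of theories with $\mathcal{T}\models\mathcal{T}^l\rightarrow\mathcal{T}^u$. An $\alpha$-abstraction from a source theory $\mathcal{T}_S$ with respect to a bridging theory $\mathcal{T}_B$ over a vocabulary $\mathcal{V}_A$ is any pair $\langle\mathcal{T}^l,\mathcal{T}^u\rangle$ of theories over $\mathcal{V}_A$ such that: for every formula $C$ over $\mathcal{V}_A$, if $\mathcal{T}_B\models C\rightarrow\mathcal{T}^l$ then $\mathcal{T}_B\models C\rightarrow\mathcal{T}_S$; and for every formula $D$ over $\mathcal{V}_A$, if $\mathcal{T}_B\models\mathcal{T}^u\rightarrow D$ then $\mathcal{T}_B\models\mathcal{T}_S\rightarrow D$. -}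

module Defs where

open import Data.Nat using (ℕ)
open import Data.Bool using (Bool; true; false; not; _∧_; _∨_)
open import Data.List using (List; []; _∷_; _++_; concatMap)
open import Data.List.Relation.Unary.All using (All)
open import Data.List.Membership.Propositional using (_∈_)
open import Data.Product using (_×_)
open import Relation.Binary.PropositionalEquality using (_≡_)

Var : Set
Var = ℕ

data Formula : Set where
  var  : Var → Formula
  ⊤f   : Formula
  ⊥f   : Formula
  ¬f_  : Formula → Formula
  _∧f_ : Formula → Formula → Formula
  _∨f_ : Formula → Formula → Formula
  _⇒f_ : Formula → Formula → Formula

infixr 4 _⇒f_
infixr 6 _∧f_
infixr 5 _∨f_

Valuation : Set
Valuation = Var → Bool

⟦_⟧ : Formula → Valuation → Bool
⟦ var x ⟧ v = v x
⟦ ⊤f ⟧ v = true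
⟦ ⊥f ⟧ v = false
⟦ ¬f φ ⟧ v = not (⟦ φ ⟧ v)
⟦ φ ∧f ψ ⟧ v = ⟦ φ ⟧ v ∧ ⟦ ψ ⟧ v
⟦ φ ∨f ψ ⟧ v = ⟦ φ ⟧ v ∨ ⟦ ψ ⟧ v
⟦ φ ⇒f ψ ⟧ v = not (⟦ φ ⟧ v) ∨ ⟦ ψ ⟧ v

vars : Formula → List Var
vars (var x) = x ∷ []
vars ⊤f = []
vars ⊥f = []
vars (¬f φ) = vars φ
vars (φ ∧f ψ) = vars φ ++ vars ψ
vars (φ ∨f ψ) = vars φ ++ vars ψ
vars (φ ⇒f ψ) = vars φ ++ vars ψ

-- A theory is a finite set (list) of formulas, identified with their conjunction.
Theory : Set
Theory = List Formula

conj : Theory → Formula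
conj [] = ⊤f
conj (φ ∷ T) = φ ∧f conj T

Vocabulary : Set
Vocabulary = List Var

vocab : Theory → Vocabulary
vocab T = concatMap vars T

FormulaOver : Formula → Vocabulary → Set
FormulaOver φ V = All (_∈ V) (vars φ)

TheoryOver : Theory → Vocabulary → Set
TheoryOver T V = All (_∈ V) (vocab T)

_⊨_ : Theory → Formula → Set
T ⊨ φ = (v : Valuation) → ⟦ conj T ⟧ v ≡ true → ⟦ φ ⟧ v ≡ true

infix 2 _⊨_

IsApproximation : Theory → Theory → Theory → Set
IsApproximation T Tl Tu = T ⊨ conj Tl ⇒f conj Tu

IsAlphaAbstraction : Theory → Theory → Vocabulary → Theory → Theory → Set
IsAlphaAbstraction TS TB VA Tl Tu =
  TheoryOver Tl VA × TheoryOver Tu VA ×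
  ((C : Formula) → FormulaOver C VA → TB ⊨ C ⇒f conj Tl → TB ⊨ C ⇒f conj TS) ×
  ((D : Formula) → FormulaOver D VA → TB ⊨ conj Tu ⇒f D → TB ⊨ conj TS ⇒f D)

{-# OPTIONS --safe #-}
module Submission where

open import Defs
open import Data.Bool using (true; false; not; _∨_)
open import Data.Bool.Properties using (∨-inverseˡ)
open import Data.List using ([]; _∷_)
open import Data.List.Relation.Unary.All using ([])
open import Data.List.Relation.Unary.All.Properties using (++⁻; ++⁺)
open import Data.Product using (_,_)
open import Relation.Binary.PropositionalEquality using (_≡_; refl)

conj-over : ∀ {V} (T : Theory) → TheoryOver T V → FormulaOver (conj T) V
conj-over []      _ = []
conj-over (φ ∷ T) p with ++⁻ (vars φ) p
... | φ-over , T-over = ++⁺ φ-over (conj-over T T-over)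

not-∨-trans : ∀ a b c → not a ∨ b ≡ true → not b ∨ c ≡ true → not a ∨ c ≡ true
not-∨-trans false _     _ _  _   = refl
not-∨-trans true  true  _ _  b⇒c = b⇒c

⊨-⇒-refl : ∀ T φ → T ⊨ φ ⇒f φ
⊨-⇒-refl _ φ v _ = ∨-inverseˡ (⟦ φ ⟧ v)

⊨-⇒-trans : ∀ T φ ψ χ → T ⊨ φ ⇒f ψ → T ⊨ ψ ⇒f χ → T ⊨ φ ⇒f χ
⊨-⇒-trans _ φ ψ χ φ⇒ψ ψ⇒χ v T-holds =
  not-∨-trans (⟦ φ ⟧ v) (⟦ ψ ⟧ v) (⟦ χ ⟧ v) (φ⇒ψ v T-holds) (ψ⇒χ v T-holds)

proposition1 : (TS TB : Theory) (VA : Vocabulary) (Tl Tu : Theory) →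
    IsAlphaAbstraction TS TB VA Tl Tu → IsApproximation TB Tl Tu
proposition1 TS TB VA Tl Tu (Tl-over , Tu-over , lower , upper) =
  ⊨-⇒-trans TB (conj Tl) (conj TS) (conj Tu) Tl⇒TS TS⇒Tu
  where
  Tl⇒TS : TB ⊨ conj Tl ⇒f conj TS
  Tl⇒TS = lower (conj Tl) (conj-over Tl Tl-over) (⊨-⇒-refl TB (conj Tl))

  TS⇒Tu : TB ⊨ conj TS ⇒f conj Tu
  TS⇒Tu = upper (conj Tu) (conj-over Tu Tu-over) (⊨-⇒-refl TB (conj Tu))
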